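{- For all superposed type derivations $\mathcal{T},\mathcal{S}$ of $\mathsf{Q}\Lambda$: $\mathcal{T}\approx\mathcal{S}$ holds if and only if $\mathcal{T}\sim\mathcal{S}$ (i.e. $\mathcal{T}\approx\mathcal{S}$ has a derivation in normal form).
   Context: Calculus $\mathsf{Q}\Lambda$. Fix a finite set $\mathscr{U}$ of unitary operators, each on some $\mathbb{C}^{2^n}$ ($n$ its arity), with constant symbols $U$. Terms: $M,N::=x\mid \lvert 0\rangle_n\mid \lvert 1\rangle_n\mid U\mid M\otimes N\mid MN\mid \lambda x.M\mid \lambda\langle x,y\rangle.M$ (labels pairwise distinct). $\lvert b_1\cdots b_k\rangle$ abbreviates $\lvert b_1\rangle\otimes\cdots\otimes\lvert b_k\rangle$. Types $A::=\mathbb{B}\mid A\multimap B\mid A\otimes B$, $\mathbb{B}^n$ the $n$-fold tensor. Environments: finite sets of $x:A$, each variable at most once; $\Gamma,\Delta$ union with disjoint variables. Typing rules: $x:A\vdash x:A$; $\vdash\lvert 0\rangle_n:\mathbb{B}$; $\vdash\lvert 1\rangle_n:\mathbb{B}$; $\vdash U:\mathbb{B}^n\multimap\mathbb{B}^n$; $(\mathsf I^1_\multimap)$ from $\Gamma,x:A\vdash M:B$ infer $\Gamma\vdash\lambda x.M:A\multimap B$; $(\mathsf I^2_\multimap)$ from $\Gamma,x:A,y:B\vdash M:C$ infer $\Gamma\vdash\lambda\langle x,y\rangle.M:(A\otimes B)\multimap C$; $(\mathsf E_\multimap)$ from $\Gamma\vdash M:A\multimap B$, $\Delta\vdash N:A$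 infer $\Gamma,\Delta\vdash MN:B$; $(\mathsf I_\otimes)$ from $\Gamma\vdash M:A$, $\Delta\vdash N:B$ infer $\Gamma,\Delta\vdash M\otimes N:A\otimes B$. A superposed type derivation of type $(\Gamma,A)$ is a formal linear combination $\sum_{i=1}^n\kappa_i\pi_i$ ($\kappa_i\in\mathbb{C}$, each $\pi_i$ a derivation of some $\Gamma\vdash M_i:A$). Term constructs lift linearly: e.g. for $\mathcal{T}=\sum_i\alpha_i\pi_i$ and $\rho$ deriving $\Delta\vdash N:A$, $\mathcal{T}\rho=\sum_i\alpha_i\sigma_i$ with $\sigma_i$ obtained from $\pi_i,\rho$ by $(\mathsf E_\multimap)$; similarly $\rho\mathcal{T}$, $\lambda x.\mathcal{T}$, $\lambda\langle x,y\rangle.\mathcal{T}$, $\mathcal{T}\otimes\rho$, $\rho\otimes\mathcal{T}$. Reducts $\pi^{\to}$: for $\pi$ deriving $\Gamma\vdash(\lambda x.M)N:A$, the derivation of $\Gamma\vdash M\{N/x\}:A$ obtained by replacing the axiom for $x$ in the derivation of $M$ by the derivation of $N$; analogously for $\Gamma\vdash(\lambda\langle x,y\rangle.M)(N\otimes L):A$; for $\pi$ deriving $\vdash U\lvert b_1\cdots b_k\rangle:\mathbb{B}^k$, $\pi^{\to}=\sum_{x\in\{0,1\}^k}\kappa_x\pi_x$, with $\pi_x$ the derivation of $\vdash\lvert x\rangle:\mathbb{B}^k$ and $\kappa_x$ the coefficient of $\lvert x\rangle$ in $\mathbf{U}\lvert b_1\cdots b_k\rangle$. Equational theory: $\approx$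 is derived by the rules: $\mathsf{AX}=\{\mathsf{beta},\mathsf{beta.pair},\mathsf{quant}\}$, each concluding $\pi\approx\pi^{\to}$ in the three cases above; $\mathsf{CC}=\{\mathsf{l.a},\mathsf{r.a},\mathsf{in}.\lambda,\mathsf{in}.\lambda.\mathsf{pair},\mathsf{l.in.tens},\mathsf{r.in.tens}\}$, from $\mathcal{T}\approx\mathcal{S}$ concluding respectively $\mathcal{T}\pi\approx\mathcal{S}\pi$, $\pi\mathcal{T}\approx\pi\mathcal{S}$, $\lambda x.\mathcal{T}\approx\lambda x.\mathcal{S}$, $\lambda\langle x,y\rangle.\mathcal{T}\approx\lambda\langle x,y\rangle.\mathcal{S}$, $\mathcal{T}\otimes\pi\approx\mathcal{S}\otimes\pi$, $\pi\otimes\mathcal{T}\approx\pi\otimes\mathcal{S}$; $\mathsf{sum}$: from $\mathcal{T}\approx\mathcal{S}$ conclude $\alpha\mathcal{T}+\mathcal{V}\approx\alpha\mathcal{S}+\mathcal{V}$; $\mathsf{refl}$: $\mathcal{T}\approx\mathcal{T}$; $\mathsf{sym}$: from $\mathcal{T}\approx\mathcal{S}$ conclude $\mathcal{S}\approx\mathcal{T}$; $\mathsf{trans}$: from $\mathcal{T}\approx\mathcal{S}$ and $\mathcal{S}\approx\mathcal{V}$ conclude $\mathcal{T}\approx\mathcal{V}$ (all involved superposed derivations having matching types). A derivation of $\mathcal{T}\approx\mathcal{S}$ is in normal form, written $\mathcal{T}\sim\mathcal{S}$, iff either it is a single application of $\mathsf{refl}$, or every branch consists of an instance of a rule of $\mathsf{AX}$,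 followed possibly by instances of rules of $\mathsf{CC}$, followed possibly by instances of $\mathsf{sum}$, followed possibly by instances of $\mathsf{sym}$, followed possibly by instances of $\mathsf{trans}$ (in this order, reading from the leaves downward). -}

module Defs where

open import Level using (_⊔_)
open import Algebra.Bundles using (CommutativeRing)
open import Data.Nat using (ℕ; zero; suc; _<ᵇ_; _≡ᵇ_)
open import Data.Bool using (Bool; true; false; T; _∧_; not; if_then_else_)
open import Data.Fin using (Fin)
open import Data.Vec using (Vec; []; _∷_)
open import Data.List using (List; []; _∷_; _++_; map)
open import Data.Bool.ListAction using (any; all)
open import Data.Maybe using (Maybe; just; nothing)
open import Data.Product using (Σ; _×_; _,_; proj₁; proj₂)
open import Data.Sum using (_⊎_)
open import Relation.Binary.PropositionalEquality using (_≡_)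

Var : Set
Var = ℕ

infixr 6 _⊸_
infixr 7 _⊗_

data Ty : Set where
  𝔹   : Ty
  _⊸_ : Ty → Ty → Ty
  _⊗_ : Ty → Ty → Ty

_==ᵀ_ : Ty → Ty → Bool
𝔹 ==ᵀ 𝔹 = true
(A ⊸ B) ==ᵀ (A' ⊸ B') = (A ==ᵀ A') ∧ (B ==ᵀ B')
(A ⊗ B) ==ᵀ (A' ⊗ B') = (A ==ᵀ A') ∧ (B ==ᵀ B')
_ ==ᵀ _ = false

-- Bpow n is 𝔹^(n+1) = 𝔹 ⊗ (𝔹 ⊗ (... ⊗ 𝔹))  (n+1 factors, right-associated)
Bpow : ℕ → Ty
Bpow zero    = 𝔹
Bpow (suc n) = 𝔹 ⊗ Bpow n

-- An environment (a finite set of declarations x : A, each variable at most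
-- once) is represented canonically as a list sorted strictly by variable.
-- All environments of derivations are built from singletons by merge and
-- remove, hence are canonical.
Env : Set
Env = List (Var × Ty)

has : Var → Ty → Env → Bool
has x A = any (λ p → (proj₁ p ≡ᵇ x) ∧ (proj₂ p ==ᵀ A))

remove : Var → Env → Env
remove x [] = []
remove x (p ∷ Γ) = if proj₁ p ≡ᵇ x then remove x Γ else p ∷ remove x Γ

disjointEnv : Env → Env → Bool
disjointEnv Γ Δ = all (λ p → not (any (λ q → proj₁ p ≡ᵇ proj₁ q) Δ)) Γ

-- union of two (disjoint) sorted environments
merge : Env → Env → Env
merge [] Δ = Δ
merge (p ∷ Γ) [] = p ∷ Γ
merge (p ∷ Γ) (q ∷ Δ) =
  if proj₁ p <ᵇ proj₁ q then p ∷ merge Γ (q ∷ Δ) else q ∷ merge (p ∷ Γ) Δ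

allVecs : (n : ℕ) → List (Vec Bool n)
allVecs zero    = [] ∷ []
allVecs (suc n) = map (false ∷_) (allVecs n) ++ map (true ∷_) (allVecs n)

-- The calculus QΛ, parameterised by the scalars K (standing for ℂ) and the
-- finite set 𝒰 of gates: nU gates, gate u has arity suc (ar u), and
-- mat u b x is the coefficient of |x⟩ in U|b⟩.

module QL {c ℓ} (K : CommutativeRing c ℓ) (nU : ℕ) (ar : Fin nU → ℕ)
          (mat : (u : Fin nU) → Vec Bool (suc (ar u)) → Vec Bool (suc (ar u))
                 → CommutativeRing.Carrier K) where

  open CommutativeRing K using (0#; 1#; _+_; _*_)
    renaming (Carrier to 𝕂; _≈_ to _≈ₖ_)

  -- Terms; ket0 n / ket1 n are |0⟩_n / |1⟩_n with label n.
  data Tm : Set where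
    var  : Var → Tm
    ket0 : ℕ → Tm
    ket1 : ℕ → Tm
    gate : Fin nU → Tm
    _⊗ₜ_ : Tm → Tm → Tm
    _·_  : Tm → Tm → Tm
    lam  : Var → Tm → Tm
    lamP : Var → Var → Tm → Tm

  labels : Tm → List ℕ
  labels (var x)    = []
  labels (ket0 n)   = n ∷ []
  labels (ket1 n)   = n ∷ []
  labels (gate u)   = []
  labels (M ⊗ₜ N)   = labels M ++ labels N
  labels (M · N)    = labels M ++ labels N
  labels (lam x M)  = labels M
  labels (lamP x y M) = labels M

  -- the labels of M and N are disjoint (so labels stay pairwise distinct)
  labelsDisj : Tm → Tm → Bool
  labelsDisj M N = all (λ l → not (any (l ≡ᵇ_) (labels N))) (labels M)

  data Der : Env → Tm → Ty → Set where
    ax    : (x : Var) (A : Ty) → Der ((x , A) ∷ []) (var x) A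
    k0    : (n : ℕ) → Der [] (ket0 n) 𝔹
    k1    : (n : ℕ) → Der [] (ket1 n) 𝔹
    gt    : (u : Fin nU) → Der [] (gate u) (Bpow (ar u) ⊸ Bpow (ar u))
    lamI  : ∀ {Γ M B} (x : Var) (A : Ty) → Der Γ M B → T (has x A Γ)
          → Der (remove x Γ) (lam x M) (A ⊸ B)
    lamPI : ∀ {Γ M C} (x y : Var) (A B : Ty) → Der Γ M C
          → T (has x A Γ ∧ has y B Γ ∧ not (x ≡ᵇ y))
          → Der (remove y (remove x Γ)) (lamP x y M) ((A ⊗ B) ⊸ C)
    appE  : ∀ {Γ Δ M N A B} → Der Γ M (A ⊸ B) → Der Δ N A
          → T (disjointEnv Γ Δ ∧ labelsDisj M N)
          → Der (merge Γ Δ) (M · N) B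
    tensI : ∀ {Γ Δ M N A B} → Der Γ M A → Der Δ N B
          → T (disjointEnv Γ Δ ∧ labelsDisj M N)
          → Der (merge Γ Δ) (M ⊗ₜ N) (A ⊗ B)

  -- Superposed type derivations of type (Γ , A): formal linear combinations
  -- (lists of coefficient/derivation pairs, identified up to _≐_ below).
  SD : Env → Ty → Set c
  SD Γ A = List (𝕂 × Σ Tm (λ M → Der Γ M A))

  ⟨_⟩ : ∀ {Γ M A} → Der Γ M A → SD Γ A
  ⟨ π ⟩ = (1# , _ , π) ∷ []

  scale : ∀ {Γ A} → 𝕂 → SD Γ A → SD Γ A
  scale α = map (λ p → (α * proj₁ p , proj₂ p))

  -- Equality of formal linear combinations (the free K-module relations).
  data _≐_ {Γ A} : SD Γ A → SD Γ A → Set (c ⊔ ℓ) where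
    ≐-refl  : ∀ {t} → t ≐ t
    ≐-sym   : ∀ {t s} → t ≐ s → s ≐ t
    ≐-trans : ∀ {t s r} → t ≐ s → s ≐ r → t ≐ r
    ≐-cons  : ∀ {a b p t s} → a ≈ₖ b → t ≐ s → ((a , p) ∷ t) ≐ ((b , p) ∷ s)
    ≐-swap  : ∀ {a b p q t} → ((a , p) ∷ (b , q) ∷ t) ≐ ((b , q) ∷ (a , p) ∷ t)
    ≐-merge : ∀ {a b p t} → ((a , p) ∷ (b , p) ∷ t) ≐ ((a + b , p) ∷ t)
    ≐-zero  : ∀ {p t} → ((0# , p) ∷ t) ≐ t

  -- Linear lifting of term constructs (relationally: Lift R 𝒯 𝒯' says 𝒯'
  -- is obtained from 𝒯 by applying the construct R entrywise).

  data Lift {Γ A Γ' A'} (R : ∀ {M M'} → Der Γ M A → Der Γ' M' A' → Set)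
       : SD Γ A → SD Γ' A' → Set c where
    []  : Lift R [] []
    _∷_ : ∀ {a M M' t t'} {π : Der Γ M A} {π' : Der Γ' M' A'}
        → R π π' → Lift R t t' → Lift R ((a , M , π) ∷ t) ((a , M' , π') ∷ t')

  data IsAppL {Γ Δ N A B} (ρ : Der Δ N A)
       : ∀ {M M'} → Der Γ M (A ⊸ B) → Der (merge Γ Δ) M' B → Set where
    mk : ∀ {M} {π : Der Γ M (A ⊸ B)} d → IsAppL ρ π (appE π ρ d)

  data IsAppR {Γ Δ M A B} (ρ : Der Γ M (A ⊸ B))
       : ∀ {N N'} → Der Δ N A → Der (merge Γ Δ) N' B → Set where
    mk : ∀ {N} {π : Der Δ N A} d → IsAppR ρ π (appE ρ π d)

  data IsLam {Γ B} (x : Var) (A : Ty)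
       : ∀ {M M'} → Der Γ M B → Der (remove x Γ) M' (A ⊸ B) → Set where
    mk : ∀ {M} {π : Der Γ M B} h → IsLam x A π (lamI x A π h)

  data IsLamP {Γ C} (x y : Var) (A B : Ty)
       : ∀ {M M'} → Der Γ M C → Der (remove y (remove x Γ)) M' ((A ⊗ B) ⊸ C) → Set where
    mk : ∀ {M} {π : Der Γ M C} h → IsLamP x y A B π (lamPI x y A B π h)

  data IsTensL {Γ Δ N A B} (ρ : Der Δ N B)
       : ∀ {M M'} → Der Γ M A → Der (merge Γ Δ) M' (A ⊗ B) → Set where
    mk : ∀ {M} {π : Der Γ M A} d → IsTensL ρ π (tensI π ρ d)

  data IsTensR {Γ Δ M A B} (ρ : Der Γ M A)
       : ∀ {N N'} → Der Δ N B → Der (merge Γ Δ) N' (A ⊗ B) → Set where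
    mk : ∀ {N} {π : Der Δ N B} d → IsTensR ρ π (tensI ρ π d)

  DerAny : Set
  DerAny = Σ Env (λ Δ → Σ Tm (λ N → Σ Ty (λ A → Der Δ N A)))

  Binds : Set
  Binds = List (Var × DerAny)

  find : Var → Binds → Maybe DerAny
  find x [] = nothing
  find x (b ∷ σ) = if proj₁ b ≡ᵇ x then just (proj₂ b) else find x σ

  unbind : Var → Binds → Binds
  unbind x [] = []
  unbind x (b ∷ σ) = if proj₁ b ≡ᵇ x then unbind x σ else b ∷ unbind x σ

  -- Sub σ π π' : π' is obtained from π by replacing the axioms for the
  -- (free) variables bound in σ by the corresponding derivations.
  data Sub : Binds → ∀ {Γ M A Γ' M'} → Der Γ M A → Der Γ' M' A → Set where
    hit   : ∀ {σ x A Δ N} {ρ : Der Δ N A}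
          → find x σ ≡ just (Δ , N , A , ρ) → Sub σ (ax x A) ρ
    miss  : ∀ {σ x A} → find x σ ≡ nothing → Sub σ (ax x A) (ax x A)
    k0    : ∀ {σ n} → Sub σ (k0 n) (k0 n)
    k1    : ∀ {σ n} → Sub σ (k1 n) (k1 n)
    gt    : ∀ {σ u} → Sub σ (gt u) (gt u)
    lamI  : ∀ {σ Γ M B Γ' M' x A} {π : Der Γ M B} {π' : Der Γ' M' B} {h h'}
          → Sub (unbind x σ) π π' → Sub σ (lamI x A π h) (lamI x A π' h')
    lamPI : ∀ {σ Γ M C Γ' M' x y A B} {π : Der Γ M C} {π' : Der Γ' M' C} {h h'}
          → Sub (unbind y (unbind x σ)) π π'
          → Sub σ (lamPI x y A B π h) (lamPI x y A B π' h')
    appE  : ∀ {σ Γ Δ M N Γ' Δ' M' N' A B}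
              {π : Der Γ M (A ⊸ B)} {ρ : Der Δ N A}
              {π' : Der Γ' M' (A ⊸ B)} {ρ' : Der Δ' N' A} {d d'}
          → Sub σ π π' → Sub σ ρ ρ' → Sub σ (appE π ρ d) (appE π' ρ' d')
    tensI : ∀ {σ Γ Δ M N Γ' Δ' M' N' A B}
              {π : Der Γ M A} {ρ : Der Δ N B}
              {π' : Der Γ' M' A} {ρ' : Der Δ' N' B} {d d'}
          → Sub σ π π' → Sub σ ρ ρ' → Sub σ (tensI π ρ d) (tensI π' ρ' d')

  pack : ∀ {Δ N A} → Der Δ N A → DerAny
  pack {Δ} {N} {A} ρ = Δ , N , A , ρ

  data Beta : ∀ {Γ A M M'} → Der Γ M A → Der Γ M' A → Set where
    mk : ∀ {Γ₁ Δ M N M' x C A} {π₁ : Der Γ₁ M A} {ρ : Der Δ N C} {h d}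
           {π' : Der (merge (remove x Γ₁) Δ) M' A}
       → Sub ((x , pack ρ) ∷ []) π₁ π'
       → Beta (appE (lamI x C π₁ h) ρ d) π'

  data BetaPair : ∀ {Γ A M M'} → Der Γ M A → Der Γ M' A → Set where
    mk : ∀ {Γ₁ Δ₁ Δ₂ M N L M' x y C₁ C₂ A}
           {π₁ : Der Γ₁ M A} {ρ₁ : Der Δ₁ N C₁} {ρ₂ : Der Δ₂ L C₂} {h d₁ d}
           {π' : Der (merge (remove y (remove x Γ₁)) (merge Δ₁ Δ₂)) M' A}
       → Sub ((x , pack ρ₁) ∷ (y , pack ρ₂) ∷ []) π₁ π'
       → BetaPair (appE (lamPI x y C₁ C₂ π₁ h) (tensI ρ₁ ρ₂ d₁) d) π'

  bitD : ℕ → Bool → Σ Tm (λ M → Der [] M 𝔹)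
  bitD l false = ket0 l , k0 l
  bitD l true  = ket1 l , k1 l

  data KetD : ∀ {n M} → Vec ℕ (suc n) → Vec Bool (suc n) → Der [] M (Bpow n) → Set where
    one  : ∀ l b → KetD (l ∷ []) (b ∷ []) (proj₂ (bitD l b))
    more : ∀ {n M} l b {ls : Vec ℕ (suc n)} {bs : Vec Bool (suc n)}
             {δ : Der [] M (Bpow n)} {d}
         → KetD ls bs δ → KetD (l ∷ ls) (b ∷ bs) (tensI (proj₂ (bitD l b)) δ d)

  data QRed (u : Fin nU) (ls : Vec ℕ (suc (ar u))) (bs : Vec Bool (suc (ar u)))
       : List (Vec Bool (suc (ar u))) → SD [] (Bpow (ar u)) → Set c where
    []  : QRed u ls bs [] []
    _∷_ : ∀ {x xs M L} {δ : Der [] M (Bpow (ar u))}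
        → KetD ls x δ → QRed u ls bs xs L
        → QRed u ls bs (x ∷ xs) ((mat u bs x , M , δ) ∷ L)

  data Quant : ∀ {Γ A M} → Der Γ M A → SD Γ A → Set c where
    mk : ∀ {u ls bs M L} {δ : Der [] M (Bpow (ar u))} {d}
       → KetD ls bs δ → QRed u ls bs (allVecs (suc (ar u))) L
       → Quant (appE (gt u) δ d) L

  -- The equational theory ≈ (as derivation trees).  Every conclusion is
  -- taken up to equality _≐_ of formal linear combinations.

  infix 4 _≈_ _∼_

  data _≈_ : ∀ {Γ A} → SD Γ A → SD Γ A → Set (c ⊔ ℓ) where
    beta      : ∀ {Γ A M M'} {π : Der Γ M A} {π' : Der Γ M' A} {𝒯 𝒮}
              → Beta π π' → 𝒯 ≐ ⟨ π ⟩ → 𝒮 ≐ ⟨ π' ⟩ → 𝒯 ≈ 𝒮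
    beta-pair : ∀ {Γ A M M'} {π : Der Γ M A} {π' : Der Γ M' A} {𝒯 𝒮}
              → BetaPair π π' → 𝒯 ≐ ⟨ π ⟩ → 𝒮 ≐ ⟨ π' ⟩ → 𝒯 ≈ 𝒮
    quant     : ∀ {Γ A M} {π : Der Γ M A} {L 𝒯 𝒮}
              → Quant π L → 𝒯 ≐ ⟨ π ⟩ → 𝒮 ≐ L → 𝒯 ≈ 𝒮
    l-a       : ∀ {Γ Δ N A B} {ρ : Der Δ N A} {𝒯 𝒮 : SD Γ (A ⊸ B)} {𝒯' 𝒮' 𝒯'' 𝒮''}
              → 𝒯 ≈ 𝒮 → Lift (IsAppL ρ) 𝒯 𝒯' → Lift (IsAppL ρ) 𝒮 𝒮'
              → 𝒯'' ≐ 𝒯' → 𝒮'' ≐ 𝒮' → 𝒯'' ≈ 𝒮''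
    r-a       : ∀ {Γ Δ M A B} {ρ : Der Γ M (A ⊸ B)} {𝒯 𝒮 : SD Δ A} {𝒯' 𝒮' 𝒯'' 𝒮''}
              → 𝒯 ≈ 𝒮 → Lift (IsAppR ρ) 𝒯 𝒯' → Lift (IsAppR ρ) 𝒮 𝒮'
              → 𝒯'' ≐ 𝒯' → 𝒮'' ≐ 𝒮' → 𝒯'' ≈ 𝒮''
    in-λ      : ∀ {Γ B x A} {𝒯 𝒮 : SD Γ B} {𝒯' 𝒮' 𝒯'' 𝒮''}
              → 𝒯 ≈ 𝒮 → Lift (IsLam x A) 𝒯 𝒯' → Lift (IsLam x A) 𝒮 𝒮'
              → 𝒯'' ≐ 𝒯' → 𝒮'' ≐ 𝒮' → 𝒯'' ≈ 𝒮''
    in-λ-pair : ∀ {Γ C x y A B} {𝒯 𝒮 : SD Γ C} {𝒯' 𝒮' 𝒯'' 𝒮''}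
              → 𝒯 ≈ 𝒮 → Lift (IsLamP x y A B) 𝒯 𝒯' → Lift (IsLamP x y A B) 𝒮 𝒮'
              → 𝒯'' ≐ 𝒯' → 𝒮'' ≐ 𝒮' → 𝒯'' ≈ 𝒮''
    l-in-tens : ∀ {Γ Δ N A B} {ρ : Der Δ N B} {𝒯 𝒮 : SD Γ A} {𝒯' 𝒮' 𝒯'' 𝒮''}
              → 𝒯 ≈ 𝒮 → Lift (IsTensL ρ) 𝒯 𝒯' → Lift (IsTensL ρ) 𝒮 𝒮'
              → 𝒯'' ≐ 𝒯' → 𝒮'' ≐ 𝒮' → 𝒯'' ≈ 𝒮''
    r-in-tens : ∀ {Γ Δ M A B} {ρ : Der Γ M A} {𝒯 𝒮 : SD Δ B} {𝒯' 𝒮' 𝒯'' 𝒮''}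
              → 𝒯 ≈ 𝒮 → Lift (IsTensR ρ) 𝒯 𝒯' → Lift (IsTensR ρ) 𝒮 𝒮'
              → 𝒯'' ≐ 𝒯' → 𝒮'' ≐ 𝒮' → 𝒯'' ≈ 𝒮''
    sum       : ∀ {Γ A} {𝒯 𝒮 : SD Γ A} {𝒯' 𝒮'} (α : 𝕂) (𝒱 : SD Γ A)
              → 𝒯 ≈ 𝒮 → 𝒯' ≐ (scale α 𝒯 ++ 𝒱) → 𝒮' ≐ (scale α 𝒮 ++ 𝒱) → 𝒯' ≈ 𝒮'
    refl      : ∀ {Γ A} {𝒯 𝒮 : SD Γ A} → 𝒯 ≐ 𝒮 → 𝒯 ≈ 𝒮
    sym       : ∀ {Γ A} {𝒯 𝒮 : SD Γ A} → 𝒯 ≈ 𝒮 → 𝒮 ≈ 𝒯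
    trans     : ∀ {Γ A} {𝒯 𝒮 𝒱 : SD Γ A} → 𝒯 ≈ 𝒮 → 𝒮 ≈ 𝒱 → 𝒯 ≈ 𝒱

  data IsAX : ∀ {Γ A} {𝒯 𝒮 : SD Γ A} → 𝒯 ≈ 𝒮 → Set (c ⊔ ℓ) where
    beta      : ∀ {Γ A M M'} {π : Der Γ M A} {π' : Der Γ M' A} {𝒯 𝒮 : SD Γ A}
                  {b e e'} → IsAX (beta {π = π} {π'} {𝒯} {𝒮} b e e')
    beta-pair : ∀ {Γ A M M'} {π : Der Γ M A} {π' : Der Γ M' A} {𝒯 𝒮 : SD Γ A}
                  {b e e'} → IsAX (beta-pair {π = π} {π'} {𝒯} {𝒮} b e e')
    quant     : ∀ {Γ A M} {π : Der Γ M A} {L 𝒯 𝒮 : SD Γ A}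
                  {q e e'} → IsAX (quant {π = π} {L} {𝒯} {𝒮} q e e')

  data IsCC : ∀ {Γ A} {𝒯 𝒮 : SD Γ A} → 𝒯 ≈ 𝒮 → Set (c ⊔ ℓ) where
    ax        : ∀ {Γ A} {𝒯 𝒮 : SD Γ A} {p : 𝒯 ≈ 𝒮} → IsAX p → IsCC p
    l-a       : ∀ {Γ Δ N A B} {ρ : Der Δ N A} {𝒯 𝒮 : SD Γ (A ⊸ B)} {𝒯' 𝒮' 𝒯'' 𝒮''}
                  {p : 𝒯 ≈ 𝒮} {l : Lift (IsAppL ρ) 𝒯 𝒯'} {l' : Lift (IsAppL ρ) 𝒮 𝒮'}
                  {e : 𝒯'' ≐ 𝒯'} {e' : 𝒮'' ≐ 𝒮'}
              → IsCC p → IsCC (l-a p l l' e e')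
    r-a       : ∀ {Γ Δ M A B} {ρ : Der Γ M (A ⊸ B)} {𝒯 𝒮 : SD Δ A} {𝒯' 𝒮' 𝒯'' 𝒮''}
                  {p : 𝒯 ≈ 𝒮} {l : Lift (IsAppR ρ) 𝒯 𝒯'} {l' : Lift (IsAppR ρ) 𝒮 𝒮'}
                  {e : 𝒯'' ≐ 𝒯'} {e' : 𝒮'' ≐ 𝒮'}
              → IsCC p → IsCC (r-a p l l' e e')
    in-λ      : ∀ {Γ B x A} {𝒯 𝒮 : SD Γ B} {𝒯' 𝒮' 𝒯'' 𝒮''}
                  {p : 𝒯 ≈ 𝒮} {l : Lift (IsLam x A) 𝒯 𝒯'} {l' : Lift (IsLam x A) 𝒮 𝒮'}
                  {e : 𝒯'' ≐ 𝒯'} {e' : 𝒮'' ≐ 𝒮'}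
              → IsCC p → IsCC (in-λ p l l' e e')
    in-λ-pair : ∀ {Γ C x y A B} {𝒯 𝒮 : SD Γ C} {𝒯' 𝒮' 𝒯'' 𝒮''}
                  {p : 𝒯 ≈ 𝒮} {l : Lift (IsLamP x y A B) 𝒯 𝒯'}
                  {l' : Lift (IsLamP x y A B) 𝒮 𝒮'}
                  {e : 𝒯'' ≐ 𝒯'} {e' : 𝒮'' ≐ 𝒮'}
              → IsCC p → IsCC (in-λ-pair p l l' e e')
    l-in-tens : ∀ {Γ Δ N A B} {ρ : Der Δ N B} {𝒯 𝒮 : SD Γ A} {𝒯' 𝒮' 𝒯'' 𝒮''}
                  {p : 𝒯 ≈ 𝒮} {l : Lift (IsTensL ρ) 𝒯 𝒯'} {l' : Lift (IsTensL ρ) 𝒮 𝒮'}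
                  {e : 𝒯'' ≐ 𝒯'} {e' : 𝒮'' ≐ 𝒮'}
              → IsCC p → IsCC (l-in-tens p l l' e e')
    r-in-tens : ∀ {Γ Δ M A B} {ρ : Der Γ M A} {𝒯 𝒮 : SD Δ B} {𝒯' 𝒮' 𝒯'' 𝒮''}
                  {p : 𝒯 ≈ 𝒮} {l : Lift (IsTensR ρ) 𝒯 𝒯'} {l' : Lift (IsTensR ρ) 𝒮 𝒮'}
                  {e : 𝒯'' ≐ 𝒯'} {e' : 𝒮'' ≐ 𝒮'}
              → IsCC p → IsCC (r-in-tens p l l' e e')

  data IsSum : ∀ {Γ A} {𝒯 𝒮 : SD Γ A} → 𝒯 ≈ 𝒮 → Set (c ⊔ ℓ) where
    cc  : ∀ {Γ A} {𝒯 𝒮 : SD Γ A} {p : 𝒯 ≈ 𝒮} → IsCC p → IsSum p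
    sum : ∀ {Γ A} {𝒯 𝒮 𝒯' 𝒮' 𝒱 : SD Γ A} {α} {p : 𝒯 ≈ 𝒮}
            {e : 𝒯' ≐ (scale α 𝒯 ++ 𝒱)} {e' : 𝒮' ≐ (scale α 𝒮 ++ 𝒱)}
        → IsSum p → IsSum (sum α 𝒱 p e e')

  data IsSym : ∀ {Γ A} {𝒯 𝒮 : SD Γ A} → 𝒯 ≈ 𝒮 → Set (c ⊔ ℓ) where
    sm  : ∀ {Γ A} {𝒯 𝒮 : SD Γ A} {p : 𝒯 ≈ 𝒮} → IsSum p → IsSym p
    sym : ∀ {Γ A} {𝒯 𝒮 : SD Γ A} {p : 𝒯 ≈ 𝒮} → IsSym p → IsSym (sym p)

  data IsTrans : ∀ {Γ A} {𝒯 𝒮 : SD Γ A} → 𝒯 ≈ 𝒮 → Set (c ⊔ ℓ) where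
    sy    : ∀ {Γ A} {𝒯 𝒮 : SD Γ A} {p : 𝒯 ≈ 𝒮} → IsSym p → IsTrans p
    trans : ∀ {Γ A} {𝒯 𝒮 𝒱 : SD Γ A} {p : 𝒯 ≈ 𝒮} {q : 𝒮 ≈ 𝒱}
          → IsTrans p → IsTrans q → IsTrans (trans p q)

  data IsRefl : ∀ {Γ A} {𝒯 𝒮 : SD Γ A} → 𝒯 ≈ 𝒮 → Set (c ⊔ ℓ) where
    refl : ∀ {Γ A} {𝒯 𝒮 : SD Γ A} {e : 𝒯 ≐ 𝒮} → IsRefl (refl e)

  NormalForm : ∀ {Γ A} {𝒯 𝒮 : SD Γ A} → 𝒯 ≈ 𝒮 → Set (c ⊔ ℓ)
  NormalForm p = IsRefl p ⊎ IsTrans p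

  _∼_ : ∀ {Γ A} → SD Γ A → SD Γ A → Set (c ⊔ ℓ)
  𝒯 ∼ 𝒮 = Σ (𝒯 ≈ 𝒮) NormalForm

module Submission where

-- For
-- ≈ ⇒ ∼ we normalise a derivation by recursion on it: sum, sym and trans
-- are absorbed by the corresponding closure operations on normal forms,
-- and the only real work is a context-closure rule (𝒯ρ, ρ𝒯, λx.𝒯, …)
-- applied to a normal form, which has to be pushed down to the AX leaves.
-- The obstacle is that the intermediate superposed derivations of a
-- trans-chain need not admit the construct (its side conditions on
-- variables and labels may fail).  We therefore push a *filtered* lift,
-- which applies the construct to the entries that admit it and drops the
-- others.  Filtering is harmless at the leaves because every AX rule
-- relates derivations carrying the same set of labels (substitution and
-- the quantum rule neither create nor destroy labels), so a leaf is either
-- lifted entirely or erased to an instance of refl.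

open import Defs
open import Algebra.Bundles using (CommutativeRing)
open import Level using (_⊔_) renaming (suc to lsuc; zero to lzero)
open import Function using (_∘_; Equivalence)
open import Data.Empty using (⊥-elim)
open import Data.Unit using (tt)
open import Data.Nat using (ℕ; suc; _≡ᵇ_; _<ᵇ_)
open import Data.Nat.Properties using (≡ᵇ⇒≡; ≡⇒≡ᵇ)
open import Data.Bool using (Bool; true; false; T; _∧_; not)
open import Data.Bool.Properties using (T-∧; T-≡; T-not-≡)
open import Data.Bool.ListAction using (any; all)
open import Data.Fin using (Fin)
open import Data.Vec using (Vec; toList)
open import Data.List using (List; []; _∷_; _++_)
open import Data.List.Properties using (++-identityʳ)
open import Data.List.Membership.Propositional.Properties using (∈-++⁻; ∈-++⁺ʳ)
open import Data.List.Relation.Binary.Subset.Propositional using (_⊆_)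
open import Data.List.Relation.Binary.Subset.Propositional.Properties
  using (⊆-refl; ⊆-trans; ⊆-reflexive; xs⊆xs++ys; xs⊆ys++xs; xs⊆x∷xs; ++⁺; ++⁺ʳ; Any-resp-⊆)
open import Data.List.Relation.Unary.Any as Any using (Any; here; there)
open import Data.List.Relation.Unary.Any.Properties using (any⁺; any⁻; ++⁻)
open import Data.List.Relation.Unary.All as All using (All; []; _∷_)
open import Data.List.Relation.Unary.All.Properties using (all⁺; all⁻; anti-mono)
open import Data.Maybe using (Maybe; just; nothing)
open import Data.Product using (Σ; _×_; _,_; proj₁; proj₂; map₁)
open import Data.Sum using (_⊎_; inj₁; inj₂)
open import Relation.Binary.PropositionalEquality as Eq using (_≡_; _≢_)

T-ext : ∀ {a b} → (T a → T b) → (T b → T a) → a ≡ b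
T-ext {false} {false} _ _ = Eq.refl
T-ext {false} {true}  _ g = ⊥-elim (g tt)
T-ext {true}  {false} f _ = ⊥-elim (f tt)
T-ext {true}  {true}  _ _ = Eq.refl

not-anti : ∀ {a b} → (T a → T b) → T (not b) → T (not a)
not-anti {false}         _ _ = tt
not-anti {true} {false}  f _ = f tt
not-anti {true} {true}   _ ()

whenT : ∀ {X : Set} (b : Bool) → (T b → X) → Maybe X
whenT true  h = just (h tt)
whenT false h = nothing

whenT-true : ∀ {X : Set} b (h : T b → X) (k : T b) → whenT b h ≡ just (h k)
whenT-true true h _ = Eq.refl

whenT-false : ∀ {X : Set} b (h : T b → X) → b ≡ false → whenT b h ≡ nothing
whenT-false false h _ = Eq.refl

infix 4 _≋_

_≋_ : List ℕ → List ℕ → Set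
xs ≋ ys = xs ⊆ ys × ys ⊆ xs

≋-refl : ∀ xs → xs ≋ xs
≋-refl _ = ⊆-refl , ⊆-refl

≋-reflexive : ∀ {xs ys} → xs ≡ ys → xs ≋ ys
≋-reflexive e = ⊆-reflexive e , ⊆-reflexive (Eq.sym e)

++-lub : ∀ {A : Set} {xs ys zs : List A} → xs ⊆ zs → ys ⊆ zs → xs ++ ys ⊆ zs
++-lub {xs = xs} s t v with ∈-++⁻ xs v
... | inj₁ v∈xs = s v∈xs
... | inj₂ v∈ys = t v∈ys

++-bounded : ∀ {A : Set} {xs ys xs' ys' zs : List A}
           → xs' ⊆ xs ++ zs → ys' ⊆ ys ++ zs → xs' ++ ys' ⊆ (xs ++ ys) ++ zs
++-bounded {xs = xs} {ys} s t =
  ++-lub (⊆-trans s (++⁺ (xs⊆xs++ys xs ys) ⊆-refl))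
         (⊆-trans t (++⁺ (xs⊆ys++xs ys xs) ⊆-refl))

any-mono : ∀ {A : Set} (p : A → Bool) {xs ys} → xs ⊆ ys → T (any p xs) → T (any p ys)
any-mono p s = any⁺ p ∘ Any-resp-⊆ s ∘ any⁻ p _

disjoint : List ℕ → List ℕ → Bool
disjoint xs ys = all (λ l → not (any (l ≡ᵇ_) ys)) xs

disjoint-anti : ∀ {xs xs' ys ys'} → xs' ⊆ xs → ys' ⊆ ys
              → T (disjoint xs ys) → T (disjoint xs' ys')
disjoint-anti sx sy =
  all⁻ _ ∘ All.map (not-anti (any-mono _ sy)) ∘ anti-mono sx ∘ all⁺ _ _

disjoint-resp : ∀ {xs xs' ys ys'} → xs ≋ xs' → ys ≋ ys' → disjoint xs ys ≡ disjoint xs' ys'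
disjoint-resp (xs⊆ , ⊇xs) (ys⊆ , ⊇ys) =
  T-ext (disjoint-anti ⊇xs ⊇ys) (disjoint-anti xs⊆ ys⊆)

infix 4 _∈dom_

_∈dom_ : Var → Env → Set
x ∈dom Γ = Any (λ p → proj₁ p ≡ x) Γ

has-dom : ∀ x A Γ → T (has x A Γ) → x ∈dom Γ
has-dom x A Γ = Any.map (λ t → ≡ᵇ⇒≡ _ _ (proj₁ (Equivalence.to T-∧ t))) ∘ any⁻ _ Γ

pair-side : ∀ {x y A B Γ} → T (has x A Γ ∧ has y B Γ ∧ not (x ≡ᵇ y))
          → T (has x A Γ) × T (has y B Γ) × (x ≡ᵇ y) ≡ false
pair-side h with hx , h' ← Equivalence.to T-∧ h with hy , x≢y ← Equivalence.to T-∧ h' =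
  hx , hy , Equivalence.to T-not-≡ x≢y

remove-dom : ∀ {x y} Γ → x ∈dom remove y Γ → x ∈dom Γ × y ≢ x
remove-dom {x} {y} ((z , B) ∷ Γ) h with z ≡ᵇ y in eq
... | true = map₁ there (remove-dom Γ h)
... | false with h
...   | here z≡x = here z≡x ,
          λ y≡x → Eq.subst T eq (≡⇒≡ᵇ z y (Eq.trans z≡x (Eq.sym y≡x)))
...   | there h' = map₁ there (remove-dom Γ h')

merge-⊆ : ∀ Γ Δ → merge Γ Δ ⊆ Γ ++ Δ
merge-⊆ []      Δ  = ⊆-refl
merge-⊆ (p ∷ Γ) [] = xs⊆xs++ys (p ∷ Γ) []
merge-⊆ (p ∷ Γ) (q ∷ Δ) with proj₁ p <ᵇ proj₁ q
... | true  = λ { (here e)  → here e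
                ; (there e) → there (merge-⊆ Γ (q ∷ Δ) e) }
... | false = λ { (here e)  → ∈-++⁺ʳ (p ∷ Γ) (here e)
                ; (there e) → ++⁺ʳ (p ∷ Γ) (xs⊆x∷xs Δ q) (merge-⊆ (p ∷ Γ) Δ e) }

merge-dom : ∀ {x} Γ Δ → x ∈dom merge Γ Δ → x ∈dom Γ ⊎ x ∈dom Δ
merge-dom Γ Δ = ++⁻ Γ ∘ Any-resp-⊆ (merge-⊆ Γ Δ)

module Normalisation {c ℓ} (K : CommutativeRing c ℓ) (nU : ℕ) (ar : Fin nU → ℕ)
    (mat : (u : Fin nU) → Vec Bool (suc (ar u)) → Vec Bool (suc (ar u))
           → CommutativeRing.Carrier K) where

  open QL K nU ar mat
  open CommutativeRing K using (1#; _*_; *-congˡ; distribˡ; zeroʳ)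
    renaming (Carrier to 𝕂; sym to symₖ)

  -- The AX rules preserve the set of labels.

  boundLabels : Binds → List ℕ
  boundLabels [] = []
  boundLabels ((_ , _ , N , _) ∷ σ) = labels N ++ boundLabels σ

  unbind-⊆ : ∀ y σ → boundLabels (unbind y σ) ⊆ boundLabels σ
  unbind-⊆ y [] = ⊆-refl
  unbind-⊆ y ((z , _ , N , _) ∷ σ) with z ≡ᵇ y
  ... | true  = ⊆-trans (unbind-⊆ y σ) (xs⊆ys++xs _ (labels N))
  ... | false = ++⁺ʳ (labels N) (unbind-⊆ y σ)

  find-⊆ : ∀ x σ {Δ N A} {ρ : Der Δ N A} → find x σ ≡ just (Δ , N , A , ρ)
         → labels N ⊆ boundLabels σ
  find-⊆ x [] ()
  find-⊆ x ((z , _ , N , _) ∷ σ) e with z ≡ᵇ x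
  find-⊆ x ((z , _ , N , _) ∷ σ) Eq.refl | true = xs⊆xs++ys (labels N) _
  ... | false = ⊆-trans (find-⊆ x σ e) (xs⊆ys++xs _ (labels N))

  find-unbind : ∀ x y σ → y ≢ x → find x (unbind y σ) ≡ find x σ
  find-unbind x y [] _ = Eq.refl
  find-unbind x y ((z , D) ∷ σ) y≢x with z ≡ᵇ y in zy
  ... | false with z ≡ᵇ x
  ...   | true  = Eq.refl
  ...   | false = find-unbind x y σ y≢x
  find-unbind x y ((z , D) ∷ σ) y≢x | true with z ≡ᵇ x in zx
  ...   | false = find-unbind x y σ y≢x
  ...   | true  = ⊥-elim (y≢x (Eq.trans (Eq.sym (≡ᵇ⇒≡ z y (Eq.subst T (Eq.sym zy) tt)))
                                        (≡ᵇ⇒≡ z x (Eq.subst T (Eq.sym zx) tt))))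

  find-head : ∀ x D σ → find x ((x , D) ∷ σ) ≡ just D
  find-head x D σ rewrite Equivalence.to T-≡ (≡⇒≡ᵇ x x Eq.refl) = Eq.refl

  find-skip : ∀ x y D σ → (x ≡ᵇ y) ≡ false → find y ((x , D) ∷ σ) ≡ find y σ
  find-skip x y D σ x≢y rewrite x≢y = Eq.refl

  sub-keeps : ∀ {σ Γ M A Γ' M'} {π : Der Γ M A} {π' : Der Γ' M' A}
            → Sub σ π π' → labels M ⊆ labels M'
  sub-keeps (hit _)     = λ ()
  sub-keeps (miss _)    = ⊆-refl
  sub-keeps k0          = ⊆-refl
  sub-keeps k1          = ⊆-refl
  sub-keeps gt          = ⊆-refl
  sub-keeps (lamI s)    = sub-keeps s
  sub-keeps (lamPI s)   = sub-keeps s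
  sub-keeps (appE s t)  = ++⁺ (sub-keeps s) (sub-keeps t)
  sub-keeps (tensI s t) = ++⁺ (sub-keeps s) (sub-keeps t)

  sub-bounded : ∀ {σ Γ M A Γ' M'} {π : Der Γ M A} {π' : Der Γ' M' A}
              → Sub σ π π' → labels M' ⊆ labels M ++ boundLabels σ
  sub-bounded (hit {σ} {x} e)          = find-⊆ x σ e
  sub-bounded (miss _)                 = λ ()
  sub-bounded (k0 {σ} {n})             = xs⊆xs++ys (n ∷ []) (boundLabels σ)
  sub-bounded (k1 {σ} {n})             = xs⊆xs++ys (n ∷ []) (boundLabels σ)
  sub-bounded gt                       = λ ()
  sub-bounded (lamI {σ} {x = x} s)     =
    ⊆-trans (sub-bounded s) (++⁺ʳ _ (unbind-⊆ x σ))
  sub-bounded (lamPI {σ} {x = x} {y} s) =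
    ⊆-trans (sub-bounded s) (++⁺ʳ _ (⊆-trans (unbind-⊆ y (unbind x σ)) (unbind-⊆ x σ)))
  sub-bounded (appE {M = M} {N} s t)   =
    ++-bounded {xs = labels M} {labels N} (sub-bounded s) (sub-bounded t)
  sub-bounded (tensI {M = M} {N} s t)  =
    ++-bounded {xs = labels M} {labels N} (sub-bounded s) (sub-bounded t)

  -- … and does insert the labels of every derivation substituted for a
  -- declared (hence, by linearity, occurring) variable.
  sub-inserts : ∀ {σ Γ M A Γ' M'} {π : Der Γ M A} {π' : Der Γ' M' A}
              → Sub σ π π' → ∀ x {Δ N B} {ρ : Der Δ N B}
              → find x σ ≡ just (Δ , N , B , ρ) → x ∈dom Γ → labels N ⊆ labels M'
  sub-inserts (hit e)  x e' (here Eq.refl) with Eq.trans (Eq.sym e) e'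
  ... | Eq.refl = ⊆-refl
  sub-inserts (miss e) x e' (here Eq.refl) with Eq.trans (Eq.sym e) e'
  ... | ()
  sub-inserts (hit _)  x _ (there ())
  sub-inserts (miss _) x _ (there ())
  sub-inserts (lamI {σ} {Γ = Γ} {x = y} s) x e h =
    let (h' , y≢x) = remove-dom Γ h
    in sub-inserts s x (Eq.trans (find-unbind x y σ y≢x) e) h'
  sub-inserts (lamPI {σ} {Γ = Γ} {x = y₁} {y₂} s) x e h =
    let (h₁ , y₂≢x) = remove-dom (remove y₁ Γ) h
        (h₀ , y₁≢x) = remove-dom Γ h₁
    in sub-inserts s x (Eq.trans (find-unbind x y₂ (unbind y₁ σ) y₂≢x)
                        (Eq.trans (find-unbind x y₁ σ y₁≢x) e)) h₀
  sub-inserts (appE {Γ = Γ} {Δ} {M' = M'} {N' = N'} s t) x e h with merge-dom Γ Δ h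
  ... | inj₁ h' = ⊆-trans (sub-inserts s x e h') (xs⊆xs++ys (labels M') (labels N'))
  ... | inj₂ h' = ⊆-trans (sub-inserts t x e h') (xs⊆ys++xs (labels N') (labels M'))
  sub-inserts (tensI {Γ = Γ} {Δ} {M' = M'} {N' = N'} s t) x e h with merge-dom Γ Δ h
  ... | inj₁ h' = ⊆-trans (sub-inserts s x e h') (xs⊆xs++ys (labels M') (labels N'))
  ... | inj₂ h' = ⊆-trans (sub-inserts t x e h') (xs⊆ys++xs (labels N') (labels M'))

  beta-labels : ∀ {Γ A M M'} {π : Der Γ M A} {π' : Der Γ M' A}
              → Beta π π' → labels M' ≋ labels M
  beta-labels (mk {Γ₁} {M = M} {N} {x = x} {C} {ρ = ρ} {h} s) =
    ⊆-trans (sub-bounded s) (⊆-reflexive (Eq.cong (labels M ++_) (++-identityʳ (labels N)))) ,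
    ++-lub (sub-keeps s) (sub-inserts s x (find-head x (pack ρ) []) (has-dom x C Γ₁ h))

  beta-pair-labels : ∀ {Γ A M M'} {π : Der Γ M A} {π' : Der Γ M' A}
                   → BetaPair π π' → labels M' ≋ labels M
  beta-pair-labels (mk {Γ₁} {M = M} {N} {L} {x = x} {y} {C₁} {C₂}
                       {ρ₁ = ρ₁} {ρ₂} {h} s)
    with hx , hy , x≢y ← pair-side {x} {y} {C₁} {C₂} {Γ₁} h =
    ⊆-trans (sub-bounded s)
      (⊆-reflexive (Eq.cong (λ z → labels M ++ labels N ++ z) (++-identityʳ (labels L)))) ,
    ++-lub (sub-keeps s)
      (++-lub (sub-inserts s x (find-head x (pack ρ₁) ((y , pack ρ₂) ∷ [])) (has-dom x C₁ Γ₁ hx))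
              (sub-inserts s y (Eq.trans (find-skip x y (pack ρ₁) ((y , pack ρ₂) ∷ []) x≢y)
                                         (find-head y (pack ρ₂) []))
                           (has-dom y C₂ Γ₁ hy)))

  HasLabels : ∀ {Γ A} → List ℕ → 𝕂 × Σ Tm (λ M → Der Γ M A) → Set
  HasLabels X e = labels (proj₁ (proj₂ e)) ≋ X

  ket-labels : ∀ {n M} {ls : Vec ℕ (suc n)} {bs : Vec Bool (suc n)} {δ : Der [] M (Bpow n)}
             → KetD ls bs δ → labels M ≡ toList ls
  ket-labels (one l false)    = Eq.refl
  ket-labels (one l true)     = Eq.refl
  ket-labels (more l false k) = Eq.cong (l ∷_) (ket-labels k)
  ket-labels (more l true k)  = Eq.cong (l ∷_) (ket-labels k)

  quant-labels : ∀ {u ls bs xs L} → QRed u ls bs xs L → All (HasLabels (toList ls)) L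
  quant-labels []      = []
  quant-labels (k ∷ q) = ≋-reflexive (ket-labels k) ∷ quant-labels q

  -- Closure properties of normal forms.

  infixr 5 _⊙_
  _⊙_ : ∀ {Γ A} {t s r : SD Γ A} → t ≐ s → s ≐ r → t ≐ r
  _⊙_ = ≐-trans

  ≡⇒≐ : ∀ {Γ A} {t s : SD Γ A} → t ≡ s → t ≐ s
  ≡⇒≐ Eq.refl = ≐-refl

  CCForm SumForm SymForm TransForm : ∀ {Γ A} → SD Γ A → SD Γ A → Set (c ⊔ ℓ)
  CCForm    𝒯 𝒮 = Σ (𝒯 ≈ 𝒮) IsCC
  SumForm   𝒯 𝒮 = Σ (𝒯 ≈ 𝒮) IsSum
  SymForm   𝒯 𝒮 = Σ (𝒯 ≈ 𝒮) IsSym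
  TransForm 𝒯 𝒮 = Σ (𝒯 ≈ 𝒮) IsTrans

  -- Every rule concludes up to ≐, so each layer can be reframed: its
  -- endpoints may be replaced by ≐-equal superposed derivations.
  reframeCC : ∀ {Γ A} {𝒯 𝒮 𝒯' 𝒮' : SD Γ A} {p : 𝒯 ≈ 𝒮}
            → IsCC p → 𝒯' ≐ 𝒯 → 𝒮' ≐ 𝒮 → CCForm 𝒯' 𝒮'
  reframeCC (ax (beta {b = b} {e = e} {e' = e'}))      t s = beta b (t ⊙ e) (s ⊙ e') , ax beta
  reframeCC (ax (beta-pair {b = b} {e = e} {e' = e'})) t s =
    beta-pair b (t ⊙ e) (s ⊙ e') , ax beta-pair
  reframeCC (ax (quant {q = q} {e = e} {e' = e'}))     t s = quant q (t ⊙ e) (s ⊙ e') , ax quant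
  reframeCC (l-a {p = p} {l = l} {l' = l'} {e = e} {e' = e'} c) t s =
    l-a p l l' (t ⊙ e) (s ⊙ e') , l-a c
  reframeCC (r-a {p = p} {l = l} {l' = l'} {e = e} {e' = e'} c) t s =
    r-a p l l' (t ⊙ e) (s ⊙ e') , r-a c
  reframeCC (in-λ {p = p} {l = l} {l' = l'} {e = e} {e' = e'} c) t s =
    in-λ p l l' (t ⊙ e) (s ⊙ e') , in-λ c
  reframeCC (in-λ-pair {p = p} {l = l} {l' = l'} {e = e} {e' = e'} c) t s =
    in-λ-pair p l l' (t ⊙ e) (s ⊙ e') , in-λ-pair c
  reframeCC (l-in-tens {p = p} {l = l} {l' = l'} {e = e} {e' = e'} c) t s =
    l-in-tens p l l' (t ⊙ e) (s ⊙ e') , l-in-tens c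
  reframeCC (r-in-tens {p = p} {l = l} {l' = l'} {e = e} {e' = e'} c) t s =
    r-in-tens p l l' (t ⊙ e) (s ⊙ e') , r-in-tens c

  reframeSum : ∀ {Γ A} {𝒯 𝒮 𝒯' 𝒮' : SD Γ A} {p : 𝒯 ≈ 𝒮}
             → IsSum p → 𝒯' ≐ 𝒯 → 𝒮' ≐ 𝒮 → SumForm 𝒯' 𝒮'
  reframeSum (cc c) t s with q , c' ← reframeCC c t s = q , cc c'
  reframeSum (sum {𝒱 = 𝒱} {α} {p} {e} {e'} u) t s = sum α 𝒱 p (t ⊙ e) (s ⊙ e') , sum u

  reframeSym : ∀ {Γ A} {𝒯 𝒮 𝒯' 𝒮' : SD Γ A} {p : 𝒯 ≈ 𝒮}
             → IsSym p → 𝒯' ≐ 𝒯 → 𝒮' ≐ 𝒮 → SymForm 𝒯' 𝒮'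
  reframeSym (sm u)  t s with q , u' ← reframeSum u t s = q , sm u'
  reframeSym (sym y) t s with q , y' ← reframeSym y s t = sym q , sym y'

  reframeTrans : ∀ {Γ A} {𝒯 𝒮 𝒯' 𝒮' : SD Γ A} {p : 𝒯 ≈ 𝒮}
               → IsTrans p → 𝒯' ≐ 𝒯 → 𝒮' ≐ 𝒮 → TransForm 𝒯' 𝒮'
  reframeTrans (sy y) t s with q , y' ← reframeSym y t s = q , sy y'
  reframeTrans (trans a b) t s
    with p , a' ← reframeTrans a t ≐-refl
       | q , b' ← reframeTrans b ≐-refl s = trans p q , trans a' b'

  reframe : ∀ {Γ A} {𝒯 𝒮 𝒯' 𝒮' : SD Γ A} → 𝒯' ≐ 𝒯 → 𝒮' ≐ 𝒮 → 𝒯 ∼ 𝒮 → 𝒯' ∼ 𝒮'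
  reframe t s (refl e , inj₁ refl) = refl (t ⊙ e ⊙ ≐-sym s) , inj₁ refl
  reframe t s (_ , inj₂ n) with q , n' ← reframeTrans n t s = q , inj₂ n'

  -- Normal forms are symmetric: sym is pushed down to the sym layer.
  symTrans : ∀ {Γ A} {𝒯 𝒮 : SD Γ A} {p : 𝒯 ≈ 𝒮} → IsTrans p → TransForm 𝒮 𝒯
  symTrans (sy {p = p} y) = sym p , sy (sym y)
  symTrans (trans a b)
    with p , a' ← symTrans a | q , b' ← symTrans b = trans q p , trans b' a'

  sym∼ : ∀ {Γ A} {𝒯 𝒮 : SD Γ A} → 𝒯 ∼ 𝒮 → 𝒮 ∼ 𝒯
  sym∼ (refl e , inj₁ refl) = refl (≐-sym e) , inj₁ refl
  sym∼ (_ , inj₂ n) with q , n' ← symTrans n = q , inj₂ n'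

  -- Normal forms are transitive: trans is the outermost layer, and a
  -- refl-normal form is absorbed by reframing the other one.
  trans∼ : ∀ {Γ A} {𝒯 𝒮 𝒱 : SD Γ A} → 𝒯 ∼ 𝒮 → 𝒮 ∼ 𝒱 → 𝒯 ∼ 𝒱
  trans∼ (refl e , inj₁ refl) n                    = reframe e ≐-refl n
  trans∼ n@(_ , inj₂ _)      (refl e , inj₁ refl) = reframe ≐-refl (≐-sym e) n
  trans∼ (p , inj₂ a)        (q , inj₂ b)         = trans p q , inj₂ (trans a b)

  scale-++-cong : ∀ {Γ A} (α : 𝕂) (𝒱 : SD Γ A) {t s : SD Γ A}
                → t ≐ s → (scale α t ++ 𝒱) ≐ (scale α s ++ 𝒱)
  scale-++-cong α 𝒱 ≐-refl          = ≐-refl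
  scale-++-cong α 𝒱 (≐-sym r)       = ≐-sym (scale-++-cong α 𝒱 r)
  scale-++-cong α 𝒱 (≐-trans r r')  = scale-++-cong α 𝒱 r ⊙ scale-++-cong α 𝒱 r'
  scale-++-cong α 𝒱 (≐-cons a≈b r)  = ≐-cons (*-congˡ a≈b) (scale-++-cong α 𝒱 r)
  scale-++-cong α 𝒱 ≐-swap          = ≐-swap
  scale-++-cong α 𝒱 (≐-merge {a = a} {b}) = ≐-merge ⊙ ≐-cons (symₖ (distribˡ α a b)) ≐-refl
  scale-++-cong α 𝒱 ≐-zero          = ≐-cons (zeroʳ α) ≐-refl ⊙ ≐-zero

  -- Normal forms are closed under sum: sum is pushed below sym and trans.
  sumSym : ∀ {Γ A} {𝒯 𝒮 𝒯' 𝒮' : SD Γ A} {p : 𝒯 ≈ 𝒮} (α : 𝕂) (𝒱 : SD Γ A) → IsSym p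
         → 𝒯' ≐ (scale α 𝒯 ++ 𝒱) → 𝒮' ≐ (scale α 𝒮 ++ 𝒱) → SymForm 𝒯' 𝒮'
  sumSym α 𝒱 (sm {p = p} u) e e' = sum α 𝒱 p e e' , sm (sum u)
  sumSym α 𝒱 (sym y) e e' with q , y' ← sumSym α 𝒱 y e' e = sym q , sym y'

  sumTrans : ∀ {Γ A} {𝒯 𝒮 𝒯' 𝒮' : SD Γ A} {p : 𝒯 ≈ 𝒮} (α : 𝕂) (𝒱 : SD Γ A) → IsTrans p
           → 𝒯' ≐ (scale α 𝒯 ++ 𝒱) → 𝒮' ≐ (scale α 𝒮 ++ 𝒱) → TransForm 𝒯' 𝒮'
  sumTrans α 𝒱 (sy y) e e' with q , y' ← sumSym α 𝒱 y e e' = q , sy y'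
  sumTrans α 𝒱 (trans a b) e e'
    with p , a' ← sumTrans α 𝒱 a e ≐-refl
       | q , b' ← sumTrans α 𝒱 b ≐-refl e' = trans p q , trans a' b'

  sum∼ : ∀ {Γ A} {𝒯 𝒮 𝒯' 𝒮' : SD Γ A} (α : 𝕂) (𝒱 : SD Γ A) → 𝒯 ∼ 𝒮
       → 𝒯' ≐ (scale α 𝒯 ++ 𝒱) → 𝒮' ≐ (scale α 𝒮 ++ 𝒱) → 𝒯' ∼ 𝒮'
  sum∼ α 𝒱 (refl r , inj₁ refl) e e' = refl (e ⊙ scale-++-cong α 𝒱 r ⊙ ≐-sym e') , inj₁ refl
  sum∼ α 𝒱 (_ , inj₂ n) e e' with q , n' ← sumTrans α 𝒱 n e e' = q , inj₂ n'

  -- Term constructs and their filtered lifting.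

  -- A term construct sending derivations of (Γ , A) to derivations of
  -- (Γ' , A'), together with its context-closure rule.  R is its graph (as
  -- in the definition of ≈); its side condition depends only on the labels
  -- of the argument, and it transforms labels by relabel.
  record Construct (Γ : Env) (A : Ty) (Γ' : Env) (A' : Ty) : Set (lsuc lzero ⊔ c ⊔ ℓ) where
    field
      R            : ∀ {M M'} → Der Γ M A → Der Γ' M' A' → Set
      side         : List ℕ → Bool
      side-resp    : ∀ {xs ys} → xs ≋ ys → side xs ≡ side ys
      build        : ∀ {M} (π : Der Γ M A) → T (side (labels M)) → Σ Tm (λ M' → Der Γ' M' A')
      build-R      : ∀ {M} (π : Der Γ M A) (k : T (side (labels M))) → R π (proj₂ (build π k))
      R-build      : ∀ {M M'} {π : Der Γ M A} {π' : Der Γ' M' A'} → R π π'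
                   → Σ (T (side (labels M))) (λ k → build π k ≡ (M' , π'))
      relabel      : List ℕ → List ℕ
      relabel-resp : ∀ {xs ys} → xs ≋ ys → relabel xs ≋ relabel ys
      build-labels : ∀ {M} (π : Der Γ M A) (k : T (side (labels M)))
                   → labels (proj₁ (build π k)) ≡ relabel (labels M)
      rule         : ∀ {𝒯 𝒮 : SD Γ A} {𝒯' 𝒮' 𝒯'' 𝒮'' : SD Γ' A'} (p : 𝒯 ≈ 𝒮) → IsCC p
                   → Lift R 𝒯 𝒯' → Lift R 𝒮 𝒮' → 𝒯'' ≐ 𝒯' → 𝒮'' ≐ 𝒮' → CCForm 𝒯'' 𝒮''

  -- What a CC-leaf relates: two ≐-equal superposed derivations (when all
  -- its redexes were dropped by filtering), or a single derivation π to a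
  -- combination of derivations all carrying the labels of π.
  data LeafShape {Γ A} (𝒯 𝒮 : SD Γ A) : Set (c ⊔ ℓ) where
    erased : 𝒯 ≐ 𝒮 → LeafShape 𝒯 𝒮
    redex  : ∀ {M} (π : Der Γ M A) (𝒮₀ : SD Γ A)
           → 𝒯 ≐ ⟨ π ⟩ → 𝒮 ≐ 𝒮₀ → All (HasLabels (labels M)) 𝒮₀ → LeafShape 𝒯 𝒮

  module FilteredLift {Γ A Γ' A'} (C : Construct Γ A Γ' A') where
    open Construct C

    liftEntry : Σ Tm (λ M → Der Γ M A) → Maybe (Σ Tm (λ M' → Der Γ' M' A'))
    liftEntry (M , π) = whenT (side (labels M)) (build π)

    consIf : 𝕂 → Maybe (Σ Tm (λ M' → Der Γ' M' A')) → SD Γ' A' → SD Γ' A'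
    consIf a (just q) r = (a , q) ∷ r
    consIf a nothing  r = r

    lift : SD Γ A → SD Γ' A'
    lift [] = []
    lift ((a , e) ∷ t) = consIf a (liftEntry e) (lift t)

    lift-cong : ∀ {t s} → t ≐ s → lift t ≐ lift s
    lift-cong ≐-refl         = ≐-refl
    lift-cong (≐-sym r)      = ≐-sym (lift-cong r)
    lift-cong (≐-trans r r') = lift-cong r ⊙ lift-cong r'
    lift-cong (≐-cons {p = p} a≈b r) with liftEntry p
    ... | just _  = ≐-cons a≈b (lift-cong r)
    ... | nothing = lift-cong r
    lift-cong (≐-swap {p = p} {q}) with liftEntry p | liftEntry q
    ... | just _  | just _  = ≐-swap
    ... | just _  | nothing = ≐-refl
    ... | nothing | _       = ≐-refl
    lift-cong (≐-merge {p = p}) with liftEntry p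
    ... | just _  = ≐-merge
    ... | nothing = ≐-refl
    lift-cong (≐-zero {p = p}) with liftEntry p
    ... | just _  = ≐-zero
    ... | nothing = ≐-refl

    lift-sum : ∀ α t v → lift (scale α t ++ v) ≡ (scale α (lift t) ++ lift v)
    lift-sum α [] v = Eq.refl
    lift-sum α ((a , e) ∷ t) v with liftEntry e
    ... | just q  = Eq.cong ((α * a , q) ∷_) (lift-sum α t v)
    ... | nothing = lift-sum α t v

    Lift⇒lift : ∀ {t t'} → Lift R t t' → lift t ≡ t'
    Lift⇒lift [] = Eq.refl
    Lift⇒lift (_∷_ {a = a} {M} {π = π} r l) with k , built ← R-build r =
      Eq.cong₂ (consIf a) (Eq.trans (whenT-true (side (labels M)) (build π) k) (Eq.cong just built))
                          (Lift⇒lift l)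

    lift-single : ∀ {M} (π : Der Γ M A) (k : T (side (labels M)))
                → lift ⟨ π ⟩ ≡ ⟨ proj₂ (build π k) ⟩
    lift-single {M} π k = Eq.cong (λ m → consIf 1# m []) (whenT-true (side (labels M)) (build π) k)

    lift-single-dropped : ∀ {M} (π : Der Γ M A) → side (labels M) ≡ false → lift ⟨ π ⟩ ≡ []
    lift-single-dropped {M} π eq =
      Eq.cong (λ m → consIf 1# m []) (whenT-false (side (labels M)) (build π) eq)

    lift-dropped : ∀ {X 𝒮₀} → side X ≡ false → All (HasLabels X) 𝒮₀ → lift 𝒮₀ ≡ []
    lift-dropped eq [] = Eq.refl
    lift-dropped eq (_∷_ {x = (_ , M₁ , π₁)} same al)
      rewrite whenT-false (side (labels M₁)) (build π₁) (Eq.trans (side-resp same) eq) =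
      lift-dropped eq al

    lift-total : ∀ {X 𝒮₀} → side X ≡ true → All (HasLabels X) 𝒮₀
               → Lift R 𝒮₀ (lift 𝒮₀) × All (HasLabels (relabel X)) (lift 𝒮₀)
    lift-total eq [] = [] , []
    lift-total {X} eq (_∷_ {x = (a , M₁ , π₁)} {xs} same al) =
      liftHead (Equivalence.from T-≡ (Eq.trans (side-resp same) eq))
      where
      liftHead : (k : T (side (labels M₁)))
               → Lift R ((a , M₁ , π₁) ∷ xs) (lift ((a , M₁ , π₁) ∷ xs))
                 × All (HasLabels (relabel X)) (lift ((a , M₁ , π₁) ∷ xs))
      liftHead k rewrite whenT-true (side (labels M₁)) (build π₁) k
        with l , al' ← lift-total eq al =
        build-R π₁ k ∷ l ,
        Eq.subst (_≋ relabel X) (Eq.sym (build-labels π₁ k)) (relabel-resp same) ∷ al'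

    -- Applying the closure rule of the construct to a CC-leaf preserves
    -- the leaf shape (the filtered lift computes the new endpoints).
    leafShape-lift : ∀ {𝒯 𝒮 : SD Γ A} {𝒯' 𝒮' 𝒯'' 𝒮'' : SD Γ' A'} → LeafShape 𝒯 𝒮
                   → Lift R 𝒯 𝒯' → Lift R 𝒮 𝒮' → 𝒯'' ≐ 𝒯' → 𝒮'' ≐ 𝒮' → LeafShape 𝒯'' 𝒮''
    leafShape-lift {𝒯} {𝒮} (erased q) l l' e e' =
      erased (e ⊙ ≡⇒≐ (Eq.sym (Lift⇒lift l)) ⊙ lift-cong q ⊙ ≡⇒≐ (Lift⇒lift l') ⊙ ≐-sym e')
    leafShape-lift {𝒯} {𝒮} (redex {M} π 𝒮₀ eT eS same) l l' e e' with side (labels M) in eq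
    ... | true = redex (proj₂ (build π k)) (lift 𝒮₀) (toT ⊙ ≡⇒≐ (lift-single π k)) (toS ⊙ lift-cong eS)
                   (Eq.subst (λ X → All (HasLabels X) (lift 𝒮₀)) (Eq.sym (build-labels π k))
                             (proj₂ (lift-total eq same)))
      where
      k = Equivalence.from T-≡ eq
      toT = e ⊙ ≡⇒≐ (Eq.sym (Lift⇒lift l)) ⊙ lift-cong eT
      toS = e' ⊙ ≡⇒≐ (Eq.sym (Lift⇒lift l'))
    ... | false = erased (e ⊙ ≡⇒≐ (Eq.sym (Lift⇒lift l)) ⊙ lift-cong eT ⊙ ≡⇒≐ (lift-single-dropped π eq)
                          ⊙ ≡⇒≐ (Eq.sym (lift-dropped eq same)) ⊙ ≐-sym (lift-cong eS)
                          ⊙ ≡⇒≐ (Lift⇒lift l') ⊙ ≐-sym e')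

  appL : ∀ {Γ Δ N A B} (ρ : Der Δ N A) → Construct Γ (A ⊸ B) (merge Γ Δ) B
  appL {Γ} {Δ} {N} ρ = record
    { R            = IsAppL ρ
    ; side         = λ xs → disjointEnv Γ Δ ∧ disjoint xs (labels N)
    ; side-resp    = λ s → Eq.cong (disjointEnv Γ Δ ∧_) (disjoint-resp s (≋-refl (labels N)))
    ; build        = λ π d → _ , appE π ρ d
    ; build-R      = λ π d → mk d
    ; R-build      = λ { (mk d) → d , Eq.refl }
    ; relabel      = λ xs → xs ++ labels N
    ; relabel-resp = λ (s , s') → ++⁺ s ⊆-refl , ++⁺ s' ⊆-refl
    ; build-labels = λ π d → Eq.refl
    ; rule         = λ p c l l' e e' → l-a p l l' e e' , l-a c
    }

  appR : ∀ {Γ Δ M A B} (ρ : Der Γ M (A ⊸ B)) → Construct Δ A (merge Γ Δ) B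
  appR {Γ} {Δ} {M} ρ = record
    { R            = IsAppR ρ
    ; side         = λ xs → disjointEnv Γ Δ ∧ disjoint (labels M) xs
    ; side-resp    = λ s → Eq.cong (disjointEnv Γ Δ ∧_) (disjoint-resp (≋-refl (labels M)) s)
    ; build        = λ π d → _ , appE ρ π d
    ; build-R      = λ π d → mk d
    ; R-build      = λ { (mk d) → d , Eq.refl }
    ; relabel      = labels M ++_
    ; relabel-resp = λ (s , s') → ++⁺ʳ (labels M) s , ++⁺ʳ (labels M) s'
    ; build-labels = λ π d → Eq.refl
    ; rule         = λ p c l l' e e' → r-a p l l' e e' , r-a c
    }

  tensL : ∀ {Γ Δ N A B} (ρ : Der Δ N B) → Construct Γ A (merge Γ Δ) (A ⊗ B)
  tensL {Γ} {Δ} {N} ρ = record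
    { R            = IsTensL ρ
    ; side         = λ xs → disjointEnv Γ Δ ∧ disjoint xs (labels N)
    ; side-resp    = λ s → Eq.cong (disjointEnv Γ Δ ∧_) (disjoint-resp s (≋-refl (labels N)))
    ; build        = λ π d → _ , tensI π ρ d
    ; build-R      = λ π d → mk d
    ; R-build      = λ { (mk d) → d , Eq.refl }
    ; relabel      = λ xs → xs ++ labels N
    ; relabel-resp = λ (s , s') → ++⁺ s ⊆-refl , ++⁺ s' ⊆-refl
    ; build-labels = λ π d → Eq.refl
    ; rule         = λ p c l l' e e' → l-in-tens p l l' e e' , l-in-tens c
    }

  tensR : ∀ {Γ Δ M A B} (ρ : Der Γ M A) → Construct Δ B (merge Γ Δ) (A ⊗ B)
  tensR {Γ} {Δ} {M} ρ = record
    { R            = IsTensR ρ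
    ; side         = λ xs → disjointEnv Γ Δ ∧ disjoint (labels M) xs
    ; side-resp    = λ s → Eq.cong (disjointEnv Γ Δ ∧_) (disjoint-resp (≋-refl (labels M)) s)
    ; build        = λ π d → _ , tensI ρ π d
    ; build-R      = λ π d → mk d
    ; R-build      = λ { (mk d) → d , Eq.refl }
    ; relabel      = labels M ++_
    ; relabel-resp = λ (s , s') → ++⁺ʳ (labels M) s , ++⁺ʳ (labels M) s'
    ; build-labels = λ π d → Eq.refl
    ; rule         = λ p c l l' e e' → r-in-tens p l l' e e' , r-in-tens c
    }

  lambda : ∀ {Γ B} (x : Var) (A : Ty) → Construct Γ B (remove x Γ) (A ⊸ B)
  lambda {Γ} x A = record
    { R            = IsLam x A
    ; side         = λ _ → has x A Γ
    ; side-resp    = λ _ → Eq.refl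
    ; build        = λ π h → _ , lamI x A π h
    ; build-R      = λ π h → mk h
    ; R-build      = λ { (mk h) → h , Eq.refl }
    ; relabel      = λ xs → xs
    ; relabel-resp = λ s → s
    ; build-labels = λ π h → Eq.refl
    ; rule         = λ p c l l' e e' → in-λ p l l' e e' , in-λ c
    }

  lambdaPair : ∀ {Γ C} (x y : Var) (A B : Ty) → Construct Γ C (remove y (remove x Γ)) ((A ⊗ B) ⊸ C)
  lambdaPair {Γ} x y A B = record
    { R            = IsLamP x y A B
    ; side         = λ _ → has x A Γ ∧ has y B Γ ∧ not (x ≡ᵇ y)
    ; side-resp    = λ _ → Eq.refl
    ; build        = λ π h → _ , lamPI x y A B π h
    ; build-R      = λ π h → mk h
    ; R-build      = λ { (mk h) → h , Eq.refl }
    ; relabel      = λ xs → xs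
    ; relabel-resp = λ s → s
    ; build-labels = λ π h → Eq.refl
    ; rule         = λ p c l l' e e' → in-λ-pair p l l' e e' , in-λ-pair c
    }

  -- Pushing constructs into normal forms.

  -- Every CC-leaf has a leaf shape: AX rules relate derivations with equal
  -- label sets, and each CC rule preserves the shape.
  leafShape : ∀ {Γ A} {𝒯 𝒮 : SD Γ A} {p : 𝒯 ≈ 𝒮} → IsCC p → LeafShape 𝒯 𝒮
  leafShape (ax (beta {b = b} {e = e} {e' = e'}))      = redex _ _ e e' (beta-labels b ∷ [])
  leafShape (ax (beta-pair {b = b} {e = e} {e' = e'})) = redex _ _ e e' (beta-pair-labels b ∷ [])
  leafShape (ax (quant {q = mk k q} {e = e} {e' = e'})) =
    redex _ _ e e' (Eq.subst (λ X → All (HasLabels X) _) (Eq.sym (ket-labels k)) (quant-labels q))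
  leafShape (l-a {ρ = ρ} {l = l} {l' = l'} {e = e} {e' = e'} c) =
    FilteredLift.leafShape-lift (appL ρ) (leafShape c) l l' e e'
  leafShape (r-a {ρ = ρ} {l = l} {l' = l'} {e = e} {e' = e'} c) =
    FilteredLift.leafShape-lift (appR ρ) (leafShape c) l l' e e'
  leafShape (in-λ {x = x} {A = A} {l = l} {l' = l'} {e = e} {e' = e'} c) =
    FilteredLift.leafShape-lift (lambda x A) (leafShape c) l l' e e'
  leafShape (in-λ-pair {x = x} {y} {A} {B} {l = l} {l' = l'} {e = e} {e' = e'} c) =
    FilteredLift.leafShape-lift (lambdaPair x y A B) (leafShape c) l l' e e'
  leafShape (l-in-tens {ρ = ρ} {l = l} {l' = l'} {e = e} {e' = e'} c) =
    FilteredLift.leafShape-lift (tensL ρ) (leafShape c) l l' e e'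
  leafShape (r-in-tens {ρ = ρ} {l = l} {l' = l'} {e = e} {e' = e'} c) =
    FilteredLift.leafShape-lift (tensR ρ) (leafShape c) l l' e e'

  module Push {Γ A Γ' A'} (C : Construct Γ A Γ' A') where
    open Construct C
    open FilteredLift C

    -- The filtered lift of a CC-leaf is a CC-leaf (via the closure rule of
    -- the construct) or, when the side condition fails, an instance of refl.
    pushCC : ∀ {𝒯 𝒮 : SD Γ A} {p : 𝒯 ≈ 𝒮} → IsCC p → lift 𝒯 ∼ lift 𝒮
    pushCC c with leafShape c
    ... | erased q = refl (lift-cong q) , inj₁ refl
    ... | redex {M} π 𝒮₀ eT eS same with side (labels M) in eq
    ...   | true with k ← Equivalence.from T-≡ eq
                     | p₀ , c₀ ← reframeCC c (≐-sym eT) (≐-sym eS)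
      with p , c' ← rule p₀ c₀ (build-R π k ∷ []) (proj₁ (lift-total eq same))
                         (lift-cong eT ⊙ ≡⇒≐ (lift-single π k)) (lift-cong eS)
      = p , inj₂ (sy (sm (cc c')))
    ...   | false =
      refl (lift-cong eT ⊙ ≡⇒≐ (lift-single-dropped π eq) ⊙ ≡⇒≐ (Eq.sym (lift-dropped eq same))
            ⊙ ≐-sym (lift-cong eS)) ,
      inj₁ refl

    pushSum : ∀ {𝒯 𝒮 : SD Γ A} {p : 𝒯 ≈ 𝒮} → IsSum p → lift 𝒯 ∼ lift 𝒮
    pushSum (cc c) = pushCC c
    pushSum (sum {𝒯 = 𝒯} {𝒮} {𝒱 = 𝒱} {α} {e = e} {e'} u) =
      sum∼ α (lift 𝒱) (pushSum u) (lift-cong e ⊙ ≡⇒≐ (lift-sum α 𝒯 𝒱))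
                                  (lift-cong e' ⊙ ≡⇒≐ (lift-sum α 𝒮 𝒱))

    pushSym : ∀ {𝒯 𝒮 : SD Γ A} {p : 𝒯 ≈ 𝒮} → IsSym p → lift 𝒯 ∼ lift 𝒮
    pushSym (sm u)  = pushSum u
    pushSym (sym y) = sym∼ (pushSym y)

    pushTrans : ∀ {𝒯 𝒮 : SD Γ A} {p : 𝒯 ≈ 𝒮} → IsTrans p → lift 𝒯 ∼ lift 𝒮
    pushTrans (sy y)      = pushSym y
    pushTrans (trans a b) = trans∼ (pushTrans a) (pushTrans b)

    cc∼ : ∀ {𝒯 𝒮 : SD Γ A} {𝒯' 𝒮' 𝒯'' 𝒮'' : SD Γ' A'} → 𝒯 ∼ 𝒮
        → Lift R 𝒯 𝒯' → Lift R 𝒮 𝒮' → 𝒯'' ≐ 𝒯' → 𝒮'' ≐ 𝒮' → 𝒯'' ∼ 𝒮''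
    cc∼ n l l' e e' =
      reframe (e ⊙ ≡⇒≐ (Eq.sym (Lift⇒lift l))) (e' ⊙ ≡⇒≐ (Eq.sym (Lift⇒lift l'))) (pushed n)
      where
      pushed : ∀ {𝒯 𝒮 : SD Γ A} → 𝒯 ∼ 𝒮 → lift 𝒯 ∼ lift 𝒮
      pushed (refl r , inj₁ refl) = refl (lift-cong r) , inj₁ refl
      pushed (_ , inj₂ t)         = pushTrans t

  normalise : ∀ {Γ A} {𝒯 𝒮 : SD Γ A} → 𝒯 ≈ 𝒮 → 𝒯 ∼ 𝒮
  normalise p@(beta _ _ _)      = p , inj₂ (sy (sm (cc (ax beta))))
  normalise p@(beta-pair _ _ _) = p , inj₂ (sy (sm (cc (ax beta-pair))))
  normalise p@(quant _ _ _)     = p , inj₂ (sy (sm (cc (ax quant))))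
  normalise (l-a {ρ = ρ} p l l' e e')       = Push.cc∼ (appL ρ) (normalise p) l l' e e'
  normalise (r-a {ρ = ρ} p l l' e e')       = Push.cc∼ (appR ρ) (normalise p) l l' e e'
  normalise (in-λ {x = x} {A = A} p l l' e e') = Push.cc∼ (lambda x A) (normalise p) l l' e e'
  normalise (in-λ-pair {x = x} {y} {A} {B} p l l' e e') =
    Push.cc∼ (lambdaPair x y A B) (normalise p) l l' e e'
  normalise (l-in-tens {ρ = ρ} p l l' e e') = Push.cc∼ (tensL ρ) (normalise p) l l' e e'
  normalise (r-in-tens {ρ = ρ} p l l' e e') = Push.cc∼ (tensR ρ) (normalise p) l l' e e'
  normalise (sum α 𝒱 p e e')                = sum∼ α 𝒱 (normalise p) e e'
  normalise (refl e)                        = refl e , inj₁ refl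
  normalise (sym p)                         = sym∼ (normalise p)
  normalise (trans p q)                     = trans∼ (normalise p) (normalise q)

mainTheorem6 : ∀ {c ℓ} (K : CommutativeRing c ℓ) (nU : ℕ) (ar : Fin nU → ℕ)
    (mat : (u : Fin nU) → Vec Bool (suc (ar u)) → Vec Bool (suc (ar u))
           → CommutativeRing.Carrier K)
    → let open QL K nU ar mat in
      ∀ {Γ A} (𝒯 𝒮 : SD Γ A) → (𝒯 ≈ 𝒮 → 𝒯 ∼ 𝒮) × (𝒯 ∼ 𝒮 → 𝒯 ≈ 𝒮)
mainTheorem6 K nU ar mat 𝒯 𝒮 = Normalisation.normalise K nU ar mat , proj₁
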